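{- Let $\mathcal{H}$ be a 1-universal class of hash functions from $U$ to $M$, with $m = |M|$, and let $S \subseteq U$ with $|S| = n$. Choose $h \in \mathcal{H}$ uniformly at random and for $i \in M$ let $B_i = \{y \in S \mid h(y) = i\}$. Then \[\mathbb{E}_{h\in\mathcal{H}}\bigl[\,|\{x \in S \mid |B_{h(x)}| \ge 3n/m\}|\,\bigr] < m.\]
   Context: A family $\mathcal{H}$ of functions from $U$ to $M$ is 1-universal if $\Pr_{h\in\mathcal{H}}[h(x) = h(y)] \le 1/|M|$ for all $x, y \in U$ with $x \ne y$, where $h$ is uniform in $\mathcal{H}$. -}

module Defs where

open import Data.Nat using (ℕ; zero; suc; _+_; _*_; _≤_; _≤?_)
open import Data.Fin using (Fin; _≟_)
open import Data.List using (List; []; _∷_; length; map; allFin)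
open import Data.Nat.ListAction using (sum)
open import Relation.Nullary using (Dec; yes; no; ¬_)
open import Relation.Binary.PropositionalEquality using (_≡_)

countL : {A : Set} → (P : A → Set) → ((a : A) → Dec (P a)) → List A → ℕ
countL P P? [] = 0
countL P P? (a ∷ as) with P? a
... | yes _ = suc (countL P P? as)
... | no  _ = countL P P? as

-- A hash class H = {H i | i : Fin k} of functions U → Fin m (listed without repetition).
HashFamily : Set → ℕ → ℕ → Set
HashFamily U m k = Fin k → U → Fin m

Distinct : {U : Set} {m k : ℕ} → HashFamily U m k → Set
Distinct {U} {m} {k} H = (i j : Fin k) → ((u : U) → H i u ≡ H j u) → i ≡ j

collisions : {U : Set} {m k : ℕ} → HashFamily U m k → U → U → ℕ
collisions {U} {m} {k} H x y = countL (λ i → H i x ≡ H i y) (λ i → H i x ≟ H i y) (allFin k)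

-- 1-universal: Pr_h[h x = h y] ≤ 1/m, i.e. collisions * m ≤ k, for x ≠ y
OneUniversal : {U : Set} {m k : ℕ} → HashFamily U m k → Set
OneUniversal {U} {m} {k} H = (x y : U) → ¬ (x ≡ y) → collisions H x y * m ≤ k

bucketSize : {U : Set} {m : ℕ} → List U → (U → Fin m) → Fin m → ℕ
bucketSize S h i = countL (λ y → h y ≡ i) (λ y → h y ≟ i) S

heavyCount : {U : Set} (m : ℕ) → List U → (U → Fin m) → ℕ
heavyCount m S h =
  countL (λ x → 3 * length S ≤ m * bucketSize S h (h x))
         (λ x → 3 * length S ≤? m * bucketSize S h (h x)) S

-- Σ_{h ∈ H} heavyCount(h)  (= k · E_h[heavyCount])
totalHeavy : {U : Set} {m k : ℕ} → HashFamily U m k → List U → ℕ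
totalHeavy {U} {m} {k} H S = sum (map (λ i → heavyCount m S (H i)) (allFin k))

-- Write b_i for the sizes of the buckets of h and Q_h = Σ_i b_i² for the number of ordered pairs of
-- elements of S that collide under h. A bucket with m b ≥ 3n satisfies 4nm b ≤ 3(m b − n)²; applying
-- this to every bucket and summing (Σ_i b_i = n) gives 4n·heavy(h) ≤ 3(m Q_h − n²), a variance bound.
-- Summed over h, Σ_h Q_h counts triples (h, x, y) with h x = h y, and 1-universality bounds it by
-- k n + k n (n − 1) / m. Together 4·Σ_h heavy(h) ≤ 3k(m − 1) < 4km.
module Submission where

open import Defs
open import Data.Nat using (ℕ; zero; suc; _+_; _*_; _≤_; _<_; _≤?_; z≤n; NonZero; >-nonZero)
open import Data.Nat.Properties
  using ( +-*-semiring; ≤-total; m≤n⇒∃[o]m+o≡n; m≤m+n; ≤-reflexive; ≤-trans; +-mono-≤; +-monoʳ-≤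
        ; +-monoˡ-≤; *-mono-≤; *-monoʳ-≤; *-monoˡ-≤; *-cancelˡ-≤; *-cancelˡ-<; +-cancelʳ-≤
        ; *-identityˡ; *-identityʳ; +-identityʳ; *-comm; n≤1+n; m≤n*m; m<m+n; module ≤-Reasoning)
open import Data.Nat.Tactic.RingSolver using (solve-∀)
open import Data.Fin using (Fin; zero; suc; _≟_; punchIn)
open import Data.Fin.Properties using (punchInᵢ≢i)
open import Data.List using (List; []; _∷_; length; map; tabulate; lookup)
import Data.Nat.ListAction as List
open import Data.List.Relation.Unary.Unique.Propositional using (Unique)
open import Data.List.Relation.Unary.AllPairs using (_∷_)
import Data.List.Relation.Unary.All as All
open import Data.List.Membership.Propositional.Properties using (∈-lookup)
open import Algebra.Properties.Semiring.Sum +-*-semiring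
  using ( sum; sum-syntax; sum-cong-≗; sum-remove; sum-replicate-zero; ∑-comm; ∑-distrib-+
        ; *-distribˡ-sum; *-distribʳ-sum)
open import Data.Product using (_,_)
open import Data.Sum using (inj₁; inj₂)
open import Data.Empty using (⊥-elim)
open import Relation.Nullary using (Dec; yes; no; ¬_)
open import Relation.Binary.PropositionalEquality
  using (_≡_; _≢_; refl; sym; trans; cong; cong₂; subst; subst₂; module ≡-Reasoning)
open import Function using (_∘_; id)
open import Function.Definitions using (Injective)

𝟙 : {P : Set} → Dec P → ℕ
𝟙 (yes _) = 1
𝟙 (no _) = 0

𝟙-yes : {P : Set} (d : Dec P) → P → 𝟙 d ≡ 1
𝟙-yes (yes _) _ = refl
𝟙-yes (no ¬p) p = ⊥-elim (¬p p)

𝟙-no : {P : Set} (d : Dec P) → ¬ P → 𝟙 d ≡ 0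
𝟙-no (yes p) ¬p = ⊥-elim (¬p p)
𝟙-no (no _) _ = refl

∑-const : ∀ n c → ∑[ i < n ] c ≡ n * c
∑-const zero c = refl
∑-const (suc n) c = cong (c +_) (∑-const n c)

∑-affine : ∀ {n} c d (f : Fin n → ℕ) → ∑[ i < n ] (c * f i + d) ≡ c * ∑[ i < n ] f i + n * d
∑-affine {n} c d f = begin
  ∑[ i < n ] (c * f i + d)            ≡⟨ ∑-distrib-+ (λ i → c * f i) (λ _ → d) ⟩
  ∑[ i < n ] (c * f i) + ∑[ i < n ] d ≡⟨ cong₂ _+_ (sym (*-distribˡ-sum c f)) (∑-const n d) ⟩
  c * ∑[ i < n ] f i + n * d          ∎
  where open ≡-Reasoning

∑-mono-≤ : ∀ {n} {f g : Fin n → ℕ} → (∀ i → f i ≤ g i) → ∑[ i < n ] f i ≤ ∑[ i < n ] g i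
∑-mono-≤ {zero} f≤g = z≤n
∑-mono-≤ {suc n} f≤g = +-mono-≤ (f≤g zero) (∑-mono-≤ (f≤g ∘ suc))

∑-≤-except : ∀ {n} (t : Fin n → ℕ) (a : Fin n) {c} → (∀ b → b ≢ a → t b ≤ c) →
             ∑[ b < n ] t b + c ≤ t a + n * c
∑-≤-except {suc n} t a {c} t≤c = begin
  ∑[ b < suc n ] t b + c               ≡⟨ cong (_+ c) (sum-remove t) ⟩
  t a + ∑[ l < n ] t (punchIn a l) + c ≤⟨ +-monoˡ-≤ c (+-monoʳ-≤ (t a) others) ⟩
  t a + n * c + c                      ≡⟨ identity (t a) n c ⟩
  t a + suc n * c                      ∎
  where
  open ≤-Reasoning
  others : ∑[ l < n ] t (punchIn a l) ≤ n * c
  others = ≤-trans (∑-mono-≤ (λ l → t≤c (punchIn a l) (punchInᵢ≢i a l))) (≤-reflexive (∑-const n c))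
  identity : ∀ u n c → u + n * c + c ≡ u + suc n * c
  identity = solve-∀

∑-𝟙-≟ : ∀ {m} (j : Fin m) (f : Fin m → ℕ) → ∑[ i < m ] (𝟙 (j ≟ i) * f i) ≡ f j
∑-𝟙-≟ {suc m} j f = begin
  ∑[ i < suc m ] (𝟙 (j ≟ i) * f i)                                     ≡⟨ sum-remove (λ i → 𝟙 (j ≟ i) * f i) ⟩
  𝟙 (j ≟ j) * f j + ∑[ l < m ] (𝟙 (j ≟ punchIn j l) * f (punchIn j l)) ≡⟨ cong₂ _+_ diagonal off-diagonal ⟩
  f j + 0                                                              ≡⟨ +-identityʳ (f j) ⟩
  f j                                                                  ∎
  where
  open ≡-Reasoning
  diagonal : 𝟙 (j ≟ j) * f j ≡ f j
  diagonal = trans (cong (_* f j) (𝟙-yes (j ≟ j) refl)) (*-identityˡ (f j))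
  off-diagonal : ∑[ l < m ] (𝟙 (j ≟ punchIn j l) * f (punchIn j l)) ≡ 0
  off-diagonal = trans (sum-cong-≗ (λ l → cong (_* f (punchIn j l)) (𝟙-no (j ≟ punchIn j l) (punchInᵢ≢i j l ∘ sym))))
                       (sum-replicate-zero m)

∑-fibres : ∀ {n m} (g : Fin n → Fin m) (f : Fin m → ℕ) →
           ∑[ a < n ] f (g a) ≡ ∑[ i < m ] (∑[ a < n ] 𝟙 (g a ≟ i) * f i)
∑-fibres {n} {m} g f = begin
  ∑[ a < n ] f (g a)                        ≡⟨ sum-cong-≗ (λ a → sym (∑-𝟙-≟ (g a) f)) ⟩
  ∑[ a < n ] ∑[ i < m ] (𝟙 (g a ≟ i) * f i) ≡⟨ ∑-comm (λ a i → 𝟙 (g a ≟ i) * f i) ⟩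
  ∑[ i < m ] ∑[ a < n ] (𝟙 (g a ≟ i) * f i) ≡⟨ sum-cong-≗ (λ i → sym (*-distribʳ-sum (f i) (λ a → 𝟙 (g a ≟ i)))) ⟩
  ∑[ i < m ] (∑[ a < n ] 𝟙 (g a ≟ i) * f i) ∎
  where open ≡-Reasoning

module _ {A : Set} {P : A → Set} (P? : (a : A) → Dec (P a)) where

  countL-lookup : (xs : List A) → countL P P? xs ≡ ∑[ i < length xs ] 𝟙 (P? (lookup xs i))
  countL-lookup [] = refl
  countL-lookup (x ∷ xs) with P? x
  ... | yes _ = cong suc (countL-lookup xs)
  ... | no _ = countL-lookup xs

  countL-tabulate : ∀ {n} (f : Fin n → A) → countL P P? (tabulate f) ≡ ∑[ i < n ] 𝟙 (P? (f i))
  countL-tabulate {zero} f = refl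
  countL-tabulate {suc n} f with P? (f zero)
  ... | yes _ = cong suc (countL-tabulate (f ∘ suc))
  ... | no _ = countL-tabulate (f ∘ suc)

sum-map-tabulate : {A : Set} {n : ℕ} (f : A → ℕ) (g : Fin n → A) →
                   List.sum (map f (tabulate g)) ≡ ∑[ i < n ] f (g i)
sum-map-tabulate {n = zero} f g = refl
sum-map-tabulate {n = suc n} f g = cong (f (g zero) +_) (sum-map-tabulate f (g ∘ suc))

lookup-injective : {A : Set} {xs : List A} → Unique xs → Injective _≡_ _≡_ (lookup xs)
lookup-injective {xs = _ ∷ _} (_ ∷ _) {zero} {zero} _ = refl
lookup-injective {xs = _ ∷ _} (x∉xs ∷ _) {zero} {suc j} eq = ⊥-elim (All.lookup x∉xs (∈-lookup j) eq)
lookup-injective {xs = _ ∷ _} (x∉xs ∷ _) {suc i} {zero} eq = ⊥-elim (All.lookup x∉xs (∈-lookup i) (sym eq))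
lookup-injective {xs = _ ∷ _} (_ ∷ u) {suc i} {suc j} eq = cong suc (lookup-injective u eq)

≤-by-slack : ∀ {a b} s → a + s ≡ b → a ≤ b
≤-by-slack {a} s refl = m≤m+n a s

2xy≤x²+y² : ∀ x y → 2 * x * y ≤ x * x + y * y
2xy≤x²+y² x y with ≤-total x y
... | inj₁ x≤y with m≤n⇒∃[o]m+o≡n x≤y
...   | e , refl = ≤-by-slack (e * e) (identity x e)
  where
  identity : ∀ x e → 2 * x * (x + e) + e * e ≡ x * x + (x + e) * (x + e)
  identity = solve-∀
2xy≤x²+y² x y | inj₂ y≤x with m≤n⇒∃[o]m+o≡n y≤x
...   | e , refl = ≤-by-slack (e * e) (identity y e)
  where
  identity : ∀ y e → 2 * (y + e) * y + e * e ≡ (y + e) * (y + e) + y * y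
  identity = solve-∀

-- 4NX·[3N ≤ X] ≤ 3(X − N)², rearranged so that no subtraction occurs.
threshold-bound : ∀ N X → 4 * N * X * 𝟙 (3 * N ≤? X) + 6 * N * X ≤ 3 * (N * N + X * X)
threshold-bound N X with 3 * N ≤? X
... | no _ = subst (_≤ 3 * (N * N + X * X)) (identity N X) (*-monoʳ-≤ 3 (2xy≤x²+y² N X))
  where
  identity : ∀ N X → 3 * (2 * N * X) ≡ 4 * N * X * 0 + 6 * N * X
  identity = solve-∀
... | yes 3N≤X with m≤n⇒∃[o]m+o≡n 3N≤X
...   | e , refl = ≤-by-slack (8 * N * e + 3 * e * e) (identity N e)
  where
  identity : ∀ N e → 4 * N * (3 * N + e) * 1 + 6 * N * (3 * N + e) + (8 * N * e + 3 * e * e)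
                     ≡ 3 * (N * N + (3 * N + e) * (3 * N + e))
  identity = solve-∀

4T+3k≤3mk⇒T<mk : ∀ T m k → 1 ≤ k → 4 * T + 3 * k ≤ 3 * m * k → T < m * k
4T+3k≤3mk⇒T<mk T m k 1≤k bound = *-cancelˡ-< 4 T (m * k) (begin-strict
  4 * T         <⟨ m<m+n (4 * T) (≤-trans 1≤k (m≤n*m k 3)) ⟩
  4 * T + 3 * k ≤⟨ bound ⟩
  3 * m * k     ≡⟨ identity m k ⟩
  3 * (m * k)   ≤⟨ *-monoˡ-≤ (m * k) (n≤1+n 3) ⟩
  4 * (m * k)   ∎)
  where
  open ≤-Reasoning
  identity : ∀ m k → 3 * m * k ≡ 3 * (m * k)
  identity = solve-∀

module Buckets {U : Set} {n : ℕ} (m : ℕ) (x : Fin n → U) where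

  bucket : (U → Fin m) → Fin m → ℕ
  bucket h i = ∑[ a < n ] 𝟙 (h (x a) ≟ i)

  isHeavy : (U → Fin m) → Fin m → ℕ
  isHeavy h i = 𝟙 (3 * n ≤? m * bucket h i)

  heavy : (U → Fin m) → ℕ
  heavy h = ∑[ a < n ] isHeavy h (h (x a))

  collidingPairs : (U → Fin m) → ℕ
  collidingPairs h = ∑[ a < n ] bucket h (h (x a))

  bucket-bound : ∀ h i → bucket h i * (4 * n * m * isHeavy h i + 6 * n * m)
                         ≤ 3 * m * m * (bucket h i * bucket h i) + 3 * n * n
  bucket-bound h i = subst₂ _≤_ (identityˡ n m (bucket h i) (isHeavy h i)) (identityʳ n m (bucket h i))
                                (threshold-bound n (m * bucket h i))
    where
    identityˡ : ∀ n m b t → 4 * n * (m * b) * t + 6 * n * (m * b) ≡ b * (4 * n * m * t + 6 * n * m)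
    identityˡ = solve-∀
    identityʳ : ∀ n m b → 3 * (n * n + m * b * (m * b)) ≡ 3 * m * m * (b * b) + 3 * n * n
    identityʳ = solve-∀

  heavy-bound : .{{NonZero m}} → ∀ h → 4 * n * heavy h + 3 * n * n ≤ 3 * m * collidingPairs h
  heavy-bound h = +-cancelʳ-≤ (3 * n * n) _ _ (*-cancelˡ-≤ m (begin
    m * (4 * n * heavy h + 3 * n * n + 3 * n * n)
      ≡⟨ identityˡ m n (heavy h) ⟩
    4 * n * m * heavy h + n * (6 * n * m)
      ≡⟨ sym (∑-affine (4 * n * m) (6 * n * m) (λ a → isHeavy h (h (x a)))) ⟩
    ∑[ a < n ] (4 * n * m * isHeavy h (h (x a)) + 6 * n * m)
      ≡⟨ ∑-fibres (h ∘ x) (λ i → 4 * n * m * isHeavy h i + 6 * n * m) ⟩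
    ∑[ i < m ] (bucket h i * (4 * n * m * isHeavy h i + 6 * n * m))
      ≤⟨ ∑-mono-≤ (bucket-bound h) ⟩
    ∑[ i < m ] (3 * m * m * (bucket h i * bucket h i) + 3 * n * n)
      ≡⟨ ∑-affine (3 * m * m) (3 * n * n) (λ i → bucket h i * bucket h i) ⟩
    3 * m * m * ∑[ i < m ] (bucket h i * bucket h i) + m * (3 * n * n)
      ≡⟨ cong (λ s → 3 * m * m * s + m * (3 * n * n)) (sym (∑-fibres (h ∘ x) (bucket h))) ⟩
    3 * m * m * collidingPairs h + m * (3 * n * n)
      ≡⟨ identityʳ m n (collidingPairs h) ⟩
    m * (3 * m * collidingPairs h + 3 * n * n) ∎))
    where
    open ≤-Reasoning
    identityˡ : ∀ m n T → m * (4 * n * T + 3 * n * n + 3 * n * n) ≡ 4 * n * m * T + n * (6 * n * m)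
    identityˡ = solve-∀
    identityʳ : ∀ m n Q → 3 * m * m * Q + m * (3 * n * n) ≡ m * (3 * m * Q + 3 * n * n)
    identityʳ = solve-∀

collisionCount : {U : Set} {m k : ℕ} → HashFamily U m k → U → U → ℕ
collisionCount {k = k} H y z = ∑[ j < k ] 𝟙 (H j y ≟ H j z)

module Expectation {U : Set} {m k n : ℕ} (H : HashFamily U m k) (x : Fin n → U)
                   (universal : ∀ y z → y ≢ z → collisionCount H y z * m ≤ k)
                   (x-injective : Injective _≡_ _≡_ x) where
  open Buckets m x

  collisionCount-refl : ∀ y → collisionCount H y y ≡ k
  collisionCount-refl y =
    trans (sum-cong-≗ (λ j → 𝟙-yes (H j y ≟ H j y) refl)) (trans (∑-const k 1) (*-identityʳ k))

  ∑-collidingPairs : ∑[ j < k ] collidingPairs (H j) ≡ ∑[ a < n ] ∑[ b < n ] collisionCount H (x a) (x b)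
  ∑-collidingPairs = begin
    ∑[ j < k ] ∑[ a < n ] ∑[ b < n ] 𝟙 (H j (x b) ≟ H j (x a))
      ≡⟨ ∑-comm (λ j a → ∑[ b < n ] 𝟙 (H j (x b) ≟ H j (x a))) ⟩
    ∑[ a < n ] ∑[ j < k ] ∑[ b < n ] 𝟙 (H j (x b) ≟ H j (x a))
      ≡⟨ sum-cong-≗ (λ a → ∑-comm (λ j b → 𝟙 (H j (x b) ≟ H j (x a)))) ⟩
    ∑[ a < n ] ∑[ b < n ] collisionCount H (x b) (x a)
      ≡⟨ ∑-comm (λ a b → collisionCount H (x b) (x a)) ⟩
    ∑[ b < n ] ∑[ a < n ] collisionCount H (x b) (x a) ∎
    where open ≡-Reasoning

  collision-row-bound : ∀ a → m * ∑[ b < n ] collisionCount H (x a) (x b) + k ≤ m * k + n * k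
  collision-row-bound a = begin
    m * ∑[ b < n ] collisionCount H (x a) (x b) + k   ≡⟨ cong (_+ k) (*-distribˡ-sum m (collisionCount H (x a) ∘ x)) ⟩
    ∑[ b < n ] (m * collisionCount H (x a) (x b)) + k ≤⟨ ∑-≤-except _ a off-diagonal ⟩
    m * collisionCount H (x a) (x a) + n * k          ≡⟨ cong (λ c → m * c + n * k) (collisionCount-refl (x a)) ⟩
    m * k + n * k                                     ∎
    where
    open ≤-Reasoning
    off-diagonal : ∀ b → b ≢ a → m * collisionCount H (x a) (x b) ≤ k
    off-diagonal b b≢a = subst (_≤ k) (*-comm _ m) (universal (x a) (x b) (b≢a ∘ sym ∘ x-injective))

  collision-bound : m * ∑[ a < n ] ∑[ b < n ] collisionCount H (x a) (x b) + n * k ≤ n * (m * k + n * k)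
  collision-bound = begin
    m * ∑[ a < n ] ∑[ b < n ] collisionCount H (x a) (x b) + n * k
      ≡⟨ sym (∑-affine m k (λ a → ∑[ b < n ] collisionCount H (x a) (x b))) ⟩
    ∑[ a < n ] (m * ∑[ b < n ] collisionCount H (x a) (x b) + k)
      ≤⟨ ∑-mono-≤ collision-row-bound ⟩
    ∑[ a < n ] (m * k + n * k)
      ≡⟨ ∑-const n _ ⟩
    n * (m * k + n * k) ∎
    where open ≤-Reasoning

  heavy-collision-bound : .{{NonZero m}} →
    4 * n * ∑[ j < k ] heavy (H j) + k * (3 * n * n) ≤ 3 * m * ∑[ a < n ] ∑[ b < n ] collisionCount H (x a) (x b)
  heavy-collision-bound = begin
    4 * n * ∑[ j < k ] heavy (H j) + k * (3 * n * n) ≡⟨ sym (∑-affine (4 * n) (3 * n * n) (heavy ∘ H)) ⟩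
    ∑[ j < k ] (4 * n * heavy (H j) + 3 * n * n)      ≤⟨ ∑-mono-≤ (heavy-bound ∘ H) ⟩
    ∑[ j < k ] (3 * m * collidingPairs (H j))         ≡⟨ sym (*-distribˡ-sum (3 * m) (collidingPairs ∘ H)) ⟩
    3 * m * ∑[ j < k ] collidingPairs (H j)           ≡⟨ cong (3 * m *_) ∑-collidingPairs ⟩
    3 * m * ∑[ a < n ] ∑[ b < n ] collisionCount H (x a) (x b) ∎
    where open ≤-Reasoning

  total-heavy-bound : .{{NonZero m}} → .{{NonZero n}} → 4 * ∑[ j < k ] heavy (H j) + 3 * k ≤ 3 * m * k
  total-heavy-bound = *-cancelˡ-≤ n (+-cancelʳ-≤ (k * (3 * n * n)) _ _ (begin
    n * (4 * T + 3 * k) + k * (3 * n * n)     ≡⟨ identity₁ n k T ⟩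
    4 * n * T + k * (3 * n * n) + 3 * (n * k) ≤⟨ +-monoˡ-≤ (3 * (n * k)) heavy-collision-bound ⟩
    3 * m * P + 3 * (n * k)                   ≡⟨ identity₂ m P (n * k) ⟩
    3 * (m * P + n * k)                       ≤⟨ *-monoʳ-≤ 3 collision-bound ⟩
    3 * (n * (m * k + n * k))                 ≡⟨ identity₃ n m k ⟩
    n * (3 * m * k) + k * (3 * n * n)         ∎))
    where
    open ≤-Reasoning
    T = ∑[ j < k ] heavy (H j)
    P = ∑[ a < n ] ∑[ b < n ] collisionCount H (x a) (x b)
    identity₁ : ∀ n k T → n * (4 * T + 3 * k) + k * (3 * n * n) ≡ 4 * n * T + k * (3 * n * n) + 3 * (n * k)
    identity₁ = solve-∀
    identity₂ : ∀ m P c → 3 * m * P + 3 * c ≡ 3 * (m * P + c)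
    identity₂ = solve-∀
    identity₃ : ∀ n m k → 3 * (n * (m * k + n * k)) ≡ n * (3 * m * k) + k * (3 * n * n)
    identity₃ = solve-∀

collisions≡collisionCount : {U : Set} {m k : ℕ} (H : HashFamily U m k) → ∀ y z → collisions H y z ≡ collisionCount H y z
collisions≡collisionCount H y z = countL-tabulate (λ j → H j y ≟ H j z) id

module _ {U : Set} {m k : ℕ} (H : HashFamily U m k) (S : List U) where
  open Buckets m (lookup S)

  heavyCount≡heavy : ∀ h → heavyCount m S h ≡ heavy h
  heavyCount≡heavy h = trans (countL-lookup (λ y → 3 * length S ≤? m * bucketSize S h (h y)) S)
    (sum-cong-≗ (λ a → cong (λ b → 𝟙 (3 * length S ≤? m * b)) (countL-lookup (λ y → h y ≟ h (lookup S a)) S)))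

  totalHeavy≡∑heavy : totalHeavy H S ≡ ∑[ j < k ] heavy (H j)
  totalHeavy≡∑heavy = trans (sum-map-tabulate (λ j → heavyCount m S (H j)) id) (sum-cong-≗ (heavyCount≡heavy ∘ H))

corollary5 : {U : Set} (m k : ℕ) → 1 ≤ m → 1 ≤ k → (H : HashFamily U m k) → Distinct H → OneUniversal H
    → (S : List U) → Unique S → totalHeavy H S < m * k
corollary5 m k 1≤m 1≤k H _ universal [] _ =
  subst (_< m * k) (sym (trans (totalHeavy≡∑heavy H []) (sum-replicate-zero k))) (*-mono-≤ 1≤m 1≤k)
corollary5 m k 1≤m 1≤k H _ universal S@(_ ∷ _) unique =
  subst (_< m * k) (sym (totalHeavy≡∑heavy H S)) (4T+3k≤3mk⇒T<mk _ m k 1≤k total-heavy-bound)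
  where
  instance
    _ : NonZero m
    _ = >-nonZero 1≤m
  universal′ : ∀ y z → y ≢ z → collisionCount H y z * m ≤ k
  universal′ y z y≢z = subst (λ c → c * m ≤ k) (collisions≡collisionCount H y z) (universal y z y≢z)
  open Expectation H (lookup S) universal′ (lookup-injective unique)
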